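{- Let $\mathcal{H}$ be a Sperner hypergraph with vertices $u_1,\dots,u_n$ and hyperedges $E_1,\dots,E_m$. Let $G$ be the graph with vertex set $\{v_1,\dots,v_n\}\cup\{e_1,\dots,e_m\}\cup\{v',v^\star\}$ and edges $v_ie_j$ whenever $u_i\in E_j$, the edge $v'v^\star$, and the edges $v^\star v_i$ for all $1\le i\le n$. Then the minimal separators of $G$ are exactly $N(e_1),\dots,N(e_m)$ and $\{v^\star\}$.
   Context: A hypergraph is Sperner if no hyperedge is contained in another distinct hyperedge. A separator of a graph $G$ is a set $S\subseteq V(G)$ with $G-S$ disconnected; a minimal separator is an inclusion-wise minimal separator (every proper subset $S'$ leaves $G-S'$ connected). $N(x)$ is the open neighborhood of $x$ in $G$. -}

module Defs where

open import Data.Bool using (Bool; true; false)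
open import Data.Nat using (ℕ)
open import Data.Fin using (Fin)
open import Data.Fin.Subset using (Subset; _⊆_)
open import Data.Vec using (lookup)
open import Data.Product using (Σ; _×_; ∃)
open import Relation.Nullary using (¬_)
open import Relation.Binary.PropositionalEquality using (_≡_; _≢_)

Graph : Set → Set
Graph V = V → V → Bool

VSet : Set → Set
VSet V = V → Bool

_≐_ : {V : Set} → VSet V → VSet V → Set
S ≐ T = ∀ x → S x ≡ T x

_⊆ᵥ_ : {V : Set} → VSet V → VSet V → Set
S ⊆ᵥ T = ∀ x → S x ≡ true → T x ≡ true

_⊂ᵥ_ : {V : Set} → VSet V → VSet V → Set
S ⊂ᵥ T = S ⊆ᵥ T × ¬ (S ≐ T)

-- Walks in G - S : Reach G S x y means y is reachable from x by a walk
-- in G all of whose vertices after x lie outside S.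
data Reach {V : Set} (G : Graph V) (S : VSet V) : V → V → Set where
  here : ∀ {x} → Reach G S x x
  step : ∀ {x y z} → G x y ≡ true → S y ≡ false → Reach G S y z → Reach G S x z

-- G - S is connected: any two vertices outside S are joined by a walk
-- in G - S.  (The empty graph counts as connected.)
ConnectedMinus : {V : Set} → Graph V → VSet V → Set
ConnectedMinus G S = ∀ x y → S x ≡ false → S y ≡ false → Reach G S x y

Separator : {V : Set} → Graph V → VSet V → Set
Separator G S = ¬ ConnectedMinus G S

MinimalSeparator : {V : Set} → Graph V → VSet V → Set
MinimalSeparator G S = Separator G S × (∀ S' → S' ⊂ᵥ S → ConnectedMinus G S')

N : {V : Set} → Graph V → V → VSet V
N G x = G x

Hypergraph : ℕ → ℕ → Set
Hypergraph n m = Fin m → Subset n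

Sperner : ∀ {n m} → Hypergraph n m → Set
Sperner E = ∀ j k → j ≢ k → ¬ (E j ⊆ E k)

data Vtx (n m : ℕ) : Set where
  v     : Fin n → Vtx n m
  e     : Fin m → Vtx n m
  v′    : Vtx n m
  vstar : Vtx n m

graphG : ∀ {n m} → Hypergraph n m → Graph (Vtx n m)
graphG E (v i) (e j) = lookup (E j) i
graphG E (e j) (v i) = lookup (E j) i
graphG E v′ vstar = true
graphG E vstar v′ = true
graphG E vstar (v i) = true
graphG E (v i) vstar = true
graphG E _ _ = false

singletonStar : ∀ {n m} → VSet (Vtx n m)
singletonStar vstar = true
singletonStar _ = false

{-# OPTIONS --safe #-}
-- A vertex set S with v⋆ ∉ S leaves G - S connected as soon as every e_j ∉ S keeps
-- a neighbour outside S, since everything then reaches v⋆.  So a minimal separator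
-- either contains v⋆, and then equals the separator {v⋆} = N(v′), or contains
-- N(e_j) for some j, and then equals that separator.  Conversely, a proper subset
-- of {v⋆} misses v⋆ and every e_j keeps a neighbour because E_j ≠ ∅; a proper
-- subset of N(e_j) still misses a neighbour of e_j, and of every other e_k because
-- E_k ⊈ E_j.
module Submission where

open import Defs
open import Data.Nat using (ℕ; _<_)
open import Data.Fin using (Fin; fromℕ<) renaming (_≟_ to _≟ᶠ_)
open import Data.Fin.Subset using (Nonempty; _⊆_)
open import Data.Fin.Properties using (any?; ¬∀⟶∃¬)
open import Data.Bool using (true; false) renaming (_≟_ to _≟ᵇ_)
open import Data.Bool.Properties using (¬-not; not-¬)
open import Data.Vec using (lookup)
open import Data.Vec.Properties using ([]=⇒lookup; lookup⇒[]=)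
open import Data.Product using (_×_; ∃; _,_)
open import Data.Sum using (_⊎_; inj₁; inj₂)
open import Data.Empty using (⊥-elim)
open import Function using (_∘_)
open import Relation.Nullary using (¬_; Dec; yes; no)
open import Relation.Nullary.Decidable using (_⊎-dec_; _×-dec_; decidable-stable)
open import Relation.Binary.PropositionalEquality

module _ {V : Set} where

  ≐-sym : {S T : VSet V} → S ≐ T → T ≐ S
  ≐-sym S≐T x = sym (S≐T x)

  ⊆ᵥ-trans : {R S T : VSet V} → R ⊆ᵥ S → S ⊆ᵥ T → R ⊆ᵥ T
  ⊆ᵥ-trans R⊆S S⊆T x Rx = S⊆T x (R⊆S x Rx)

  ⊆ᵥ-antisym : {S T : VSet V} → S ⊆ᵥ T → T ⊆ᵥ S → S ≐ T
  ⊆ᵥ-antisym {S} {T} S⊆T T⊆S x with S x in Sx | T x in Tx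
  ... | true  | true  = refl
  ... | false | false = refl
  ... | true  | false = ⊥-elim (not-¬ (S⊆T x Sx) Tx)
  ... | false | true  = ⊥-elim (not-¬ (T⊆S x Tx) Sx)

  ⊆ᵥ-outside : {S T : VSet V} → S ⊆ᵥ T → ∀ x → T x ≡ false → S x ≡ false
  ⊆ᵥ-outside S⊆T x Tx = ¬-not λ Sx → not-¬ (S⊆T x Sx) Tx

module _ {V : Set} (G : Graph V) where

  Reach-trans : {S : VSet V} {x y z : V} → Reach G S x y → Reach G S y z → Reach G S x z
  Reach-trans here        r′ = r′
  Reach-trans (step g s r) r′ = step g s (Reach-trans r r′)

  Reach-resp-≐ : {S T : VSet V} {x y : V} → S ≐ T → Reach G S x y → Reach G T x y
  Reach-resp-≐ S≐T here         = here
  Reach-resp-≐ S≐T (step g s r) = step g (trans (sym (S≐T _)) s) (Reach-resp-≐ S≐T r)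

  ConnectedMinus-resp-≐ : {S T : VSet V} → S ≐ T → ConnectedMinus G S → ConnectedMinus G T
  ConnectedMinus-resp-≐ S≐T conn x y Tx Ty =
    Reach-resp-≐ S≐T (conn x y (trans (S≐T x) Tx) (trans (S≐T y) Ty))

  Separator-resp-≐ : {S T : VSet V} → S ≐ T → Separator G S → Separator G T
  Separator-resp-≐ S≐T sep conn = sep (ConnectedMinus-resp-≐ (≐-sym S≐T) conn)

  MinimalSeparator-resp-≐ : {S T : VSet V} → S ≐ T → MinimalSeparator G S → MinimalSeparator G T
  MinimalSeparator-resp-≐ S≐T (sep , minimal) =
    Separator-resp-≐ S≐T sep ,
    λ S′ (S′⊆T , S′≢T) → minimal S′
      ( (λ x S′x → trans (S≐T x) (S′⊆T x S′x))
      , λ S′≐S → S′≢T (λ x → trans (S′≐S x) (S≐T x)) )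

  connected-via-hub : {S : VSet V} (h : V) →
                      (∀ x → S x ≡ false → Reach G S x h) →
                      (∀ y → S y ≡ false → Reach G S h y) →
                      ConnectedMinus G S
  connected-via-hub h to from x y Sx Sy = Reach-trans (to x Sx) (from y Sy)

  minimalSeparator-⊇-separator : {S T : VSet V} → MinimalSeparator G S →
                                 T ⊆ᵥ S → Separator G T → S ≐ T
  minimalSeparator-⊇-separator {S} {T} (_ , minimal) T⊆S sepT =
    ⊆ᵥ-antisym S⊆T T⊆S
    where
    S⊆T : S ⊆ᵥ T
    S⊆T x Sx = ¬-not λ Tx → sepT (minimal T (T⊆S , λ T≐S → not-¬ Sx (trans (sym (T≐S x)) Tx)))

  Reach-from-N : {x y : V} → Reach G (N G x) x y → x ≡ y
  Reach-from-N here = refl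
  Reach-from-N (step g s _) with () ← trans (sym g) s

  N-separator : {x y : V} → G x x ≡ false → G x y ≡ false → x ≢ y → Separator G (N G x)
  N-separator {x} {y} Gxx Gxy x≢y conn = x≢y (Reach-from-N (conn x y Gxx Gxy))

module _ {n m : ℕ} (E : Hypergraph n m) where

  private
    G : Graph (Vtx n m)
    G = graphG E

  HasNeighbourOutside : VSet (Vtx n m) → Fin m → Set
  HasNeighbourOutside S j = ∃ λ i → lookup (E j) i ≡ true × S (v i) ≡ false

  hasNeighbourOutside? : ∀ S j → Dec (HasNeighbourOutside S j)
  hasNeighbourOutside? S j = any? λ i → (lookup (E j) i ≟ᵇ true) ×-dec (S (v i) ≟ᵇ false)

  N-e-⊆ : ∀ {S} j → ¬ HasNeighbourOutside S j → N G (e j) ⊆ᵥ S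
  N-e-⊆ j ¬out (v i) i∈Ej = ¬-not λ Svi → ¬out (i , i∈Ej , Svi)

  N-e-⊆-injective : Sperner E → ∀ {j k} → N G (e j) ⊆ᵥ N G (e k) → j ≡ k
  N-e-⊆-injective sperner {j} {k} Nj⊆Nk =
    decidable-stable (j ≟ᶠ k) λ j≢k → sperner j k j≢k Ej⊆Ek
    where
    Ej⊆Ek : E j ⊆ E k
    Ej⊆Ek {i} i∈Ej = lookup⇒[]= i (E k) (Nj⊆Nk (v i) ([]=⇒lookup i∈Ej))

  singletonStar-⊆ : {S : VSet (Vtx n m)} → S vstar ≡ true → singletonStar ⊆ᵥ S
  singletonStar-⊆ S⋆ vstar _ = S⋆

  connectedMinus-via-v⋆ : ∀ {S} → S vstar ≡ false →
                          (∀ j → S (e j) ≡ true ⊎ HasNeighbourOutside S j) →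
                          ConnectedMinus G S
  connectedMinus-via-v⋆ {S} S⋆ attached = connected-via-hub G vstar toStar fromStar
    where
    toStar : ∀ x → S x ≡ false → Reach G S x vstar
    toStar (v i) _ = step refl S⋆ here
    toStar (e j) Sej with attached j
    ... | inj₁ Sej′ = ⊥-elim (not-¬ Sej′ Sej)
    ... | inj₂ (i , i∈Ej , Svi) = step i∈Ej Svi (step refl S⋆ here)
    toStar v′ _ = step refl S⋆ here
    toStar vstar _ = here

    fromStar : ∀ y → S y ≡ false → Reach G S vstar y
    fromStar (v i) Svi = step refl Svi here
    fromStar (e j) Sej with attached j
    ... | inj₁ Sej′ = ⊥-elim (not-¬ Sej′ Sej)
    ... | inj₂ (i , i∈Ej , Svi) = step refl Svi (step i∈Ej Sej here)
    fromStar v′ Sv′ = step refl Sv′ here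
    fromStar vstar _ = here

  N-e-separator : ∀ j → Separator G (N G (e j))
  N-e-separator j = N-separator G {x = e j} {y = vstar} refl refl λ ()

  N-v′≐singletonStar : N G v′ ≐ singletonStar
  N-v′≐singletonStar (v i) = refl
  N-v′≐singletonStar (e j) = refl
  N-v′≐singletonStar v′    = refl
  N-v′≐singletonStar vstar = refl

  singletonStar-separator : 0 < n → Separator G singletonStar
  singletonStar-separator 0<n =
    Separator-resp-≐ G N-v′≐singletonStar (N-separator G {x = v′} {y = v (fromℕ< 0<n)} refl refl λ ())

  singletonStar-minimal : (∀ j → Nonempty (E j)) →
                          ∀ S → S ⊂ᵥ singletonStar → ConnectedMinus G S
  singletonStar-minimal nonempty S (S⊆⋆ , S≢⋆) = connectedMinus-via-v⋆ S⋆ (inj₂ ∘ attached)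
    where
    S⋆ : S vstar ≡ false
    S⋆ = ¬-not λ S⋆ → S≢⋆ (⊆ᵥ-antisym S⊆⋆ (singletonStar-⊆ S⋆))

    attached : ∀ j → HasNeighbourOutside S j
    attached j with (i , i∈Ej) ← nonempty j = i , []=⇒lookup i∈Ej , ⊆ᵥ-outside S⊆⋆ (v i) refl

  N-e-minimal : Sperner E → ∀ j S → S ⊂ᵥ N G (e j) → ConnectedMinus G S
  N-e-minimal sperner j S (S⊆Nj , S≢Nj) =
    connectedMinus-via-v⋆ (⊆ᵥ-outside S⊆Nj vstar refl) (inj₂ ∘ attached)
    where
    attached : ∀ k → HasNeighbourOutside S k
    attached k with hasNeighbourOutside? S k
    ... | yes out = out
    ... | no ¬out with refl ← N-e-⊆-injective sperner (⊆ᵥ-trans (N-e-⊆ k ¬out) S⊆Nj) =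
      ⊥-elim (S≢Nj (⊆ᵥ-antisym S⊆Nj (N-e-⊆ k ¬out)))

  minimalSeparator-classification : 0 < n → ∀ {S} → MinimalSeparator G S →
                                    (∃ λ j → S ≐ N G (e j)) ⊎ (S ≐ singletonStar)
  minimalSeparator-classification 0<n {S} minSep@(sep , _) with S vstar in S⋆
  ... | true = inj₂ (minimalSeparator-⊇-separator G minSep
                      (singletonStar-⊆ S⋆) (singletonStar-separator 0<n))
  ... | false with (j , ¬attached) ← ¬∀⟶∃¬ m _
                      (λ j → (S (e j) ≟ᵇ true) ⊎-dec hasNeighbourOutside? S j)
                      (sep ∘ connectedMinus-via-v⋆ S⋆) =
    inj₁ (j , minimalSeparator-⊇-separator G minSep
                (N-e-⊆ j (¬attached ∘ inj₂)) (N-e-separator j))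

lemma24 : (n m : ℕ) (E : Hypergraph n m) →
          0 < n →
          (∀ j → Nonempty (E j)) →
          Sperner E →
          (S : VSet (Vtx n m)) →
          (MinimalSeparator (graphG E) S →
             (∃ λ j → S ≐ N (graphG E) (e j)) ⊎ (S ≐ singletonStar))
          × ((∃ λ j → S ≐ N (graphG E) (e j)) ⊎ (S ≐ singletonStar) →
             MinimalSeparator (graphG E) S)
lemma24 n m E 0<n nonempty sperner S = minimalSeparator-classification E 0<n , λ where
  (inj₁ (j , S≐Nj)) → MinimalSeparator-resp-≐ (graphG E) (≐-sym S≐Nj)
                        (N-e-separator E j , N-e-minimal E sperner j)
  (inj₂ S≐⋆)        → MinimalSeparator-resp-≐ (graphG E) (≐-sym S≐⋆)
                        (singletonStar-separator E 0<n , singletonStar-minimal E nonempty)
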